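{- Let $G$ be a non-trivial finite group, $x\in G^\times$ and $m>1$ an integer. Then (1) if $x$ has order $2$, then $|I_m(x)|=m(m+1)/2$; if $x$ has order bigger than $2$, then $|I_m(x)|=m(m+1)$; (2) $\mathscr{I}_m(x)$ is a $d$-regular graph, where $d=2m-2$ if $x$ has order $2$ and $d=2m-1$ if $x$ has order bigger than $2$.
   Context: For a finite group $G$ with identity $e$, $G^\times=G\setminus\{e\}$. For $y\in G^\times$ and $1\leqslant k<l\leqslant m+1$, $\mathbf{y}_{[k,l)}\in G^m$ has $j$-th coordinate $y$ for $k\leqslant j<l$ and $e$ otherwise; $\mathcal{S}$ is the set of all such $\mathbf{y}_{[k,l)}$, and $\mathscr{G}_m(G)=Cay(G^m,\mathcal{S})$ is the graph on $G^m$ with $\mathbf{g}\sim\mathbf{h}$ iff $\mathbf{h}\mathbf{g}^{ -1}\in\mathcal{S}$. For $x\in G^\times$, $I_m(x)=\{\mathbf{x}_{[k,l)}:1\leqslant k<l\leqslant m+1\}\cup\{(\mathbf{x}^{ -1})_{[k,l)}:1\leqslant k<l\leqslant m+1\}$ and $\mathscr{I}_m(x)=\mathscr{I}_m(x,G)$ is the subgraph of $\mathscr{G}_m(G)$ induced on $I_m(x)$. -}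

module Defs where

open import Data.Nat using (ℕ; zero; suc; _≤_; _<_; _+_)
open import Data.Fin using (Fin; toℕ)
open import Data.Vec using (Vec; tabulate)
open import Data.List using (List; length)
open import Data.List.Membership.Propositional using (_∈_)
open import Data.List.Relation.Unary.Unique.Propositional using (Unique)
open import Data.Product using (Σ; _×_; ∃; ∃-syntax; _,_)
open import Data.Sum using (_⊎_)
open import Relation.Nullary using (¬_; does)
open import Relation.Binary.PropositionalEquality using (_≡_; _≢_)
open import Algebra.Structures using (IsGroup)
open import Function.Bundles using (_↔_; _⇔_)
open import Data.Bool using (if_then_else_; _∧_)
import Data.Nat as ℕ

record FiniteGroup : Set₁ where
  infixl 7 _∙_
  field
    Carrier : Set
    _∙_     : Carrier → Carrier → Carrier
    e       : Carrier
    _⁻¹     : Carrier → Carrier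
    isGroup : IsGroup _≡_ _∙_ e _⁻¹
    size    : ℕ
    enum    : Carrier ↔ Fin size

module _ (G : FiniteGroup) where
  open FiniteGroup G

  pow : Carrier → ℕ → Carrier
  pow x zero    = e
  pow x (suc k) = x ∙ pow x k

  HasOrder : Carrier → ℕ → Set
  HasOrder x k = 0 < k × pow x k ≡ e × (∀ j → 0 < j → j < k → pow x j ≢ e)

  -- y_[k,l) ∈ G^m : j-th coordinate (j = 1..m) is y if k ≤ j < l, e otherwise
  seg : (m : ℕ) → Carrier → ℕ → ℕ → Vec Carrier m
  seg m y k l = tabulate λ (j : Fin m) →
    if does (k ℕ.≤? suc (toℕ j)) ∧ does (suc (toℕ j) ℕ.<? l) then y else e

  ValidRange : ℕ → ℕ → ℕ → Set
  ValidRange m k l = 1 ≤ k × k < l × l ≤ suc m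

  InS : (m : ℕ) → Vec Carrier m → Set
  InS m v = ∃[ y ] ∃[ k ] ∃[ l ] (y ≢ e × ValidRange m k l × v ≡ seg m y k l)

  vmul : ∀ {m} → Vec Carrier m → Vec Carrier m → Vec Carrier m
  vmul = Data.Vec.zipWith _∙_

  vinv : ∀ {m} → Vec Carrier m → Vec Carrier m
  vinv = Data.Vec.map _⁻¹

  Adj : (m : ℕ) → Vec Carrier m → Vec Carrier m → Set
  Adj m g h = InS m (vmul h (vinv g))

  InI : (m : ℕ) → Carrier → Vec Carrier m → Set
  InI m x v = ∃[ k ] ∃[ l ] (ValidRange m k l × (v ≡ seg m x k l ⊎ v ≡ seg m (x ⁻¹) k l))

HasCard : {X : Set} → (X → Set) → ℕ → Set
HasCard {X} P N = Σ (List X) λ L → Unique L × length L ≡ N × (∀ v → (v ∈ L) ⇔ P v)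

module _ (G : FiniteGroup) where
  open FiniteGroup G

  CardI : (m : ℕ) → Carrier → ℕ → Set
  CardI m x N = HasCard (InI G m x) N

  IsRegularI : (m : ℕ) → Carrier → ℕ → Set
  IsRegularI m x d = ∀ v → InI G m x v → HasCard (λ w → InI G m x w × Adj G m v w) d

module Submission where

-- Segments y_[k,l) with y ≠ e are in bijection with the m(m+1)/2 index pairs 1 ≤ k < l ≤ m+1,
-- and x_[k,l) ≠ x⁻¹_[k',l') unless x² = e; this gives |I_m(x)|.  Two vertices are adjacent
-- when their coordinatewise quotient is a segment, i.e. takes a single value ≠ e on an interval
-- and is e elsewhere.  The quotient of x_[k,l) by x_[a,b) is x on [k,l)∖[a,b), x⁻¹ on [a,b)∖[k,l)
-- and e elsewhere, so the intervals must share exactly one endpoint, or abut when x = x⁻¹.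
-- For z ≠ x the quotient of z_[k,l) by x_[a,b) is z, x⁻¹ and z x⁻¹ on [k,l)∖[a,b), [a,b)∖[k,l)
-- and the intersection; z x⁻¹ differs from e, z and x⁻¹, so the intervals are equal or abut.
-- Counting these configurations gives 2m − 2, respectively 2m − 1, neighbours of every vertex.

open import Algebra.Bundles using (Group)
import Algebra.Properties.Group as GroupProperties
open import Algebra.Structures using (IsGroup)
open import Data.Bool using (Bool; true; false; if_then_else_; _∧_)
open import Data.Bool.Properties using (∧-zeroʳ)
open import Data.Empty using (⊥; ⊥-elim)
open import Data.Fin using (toℕ)
open import Data.List using ([]; _∷_; _++_; map; upTo)
open import Data.List.Membership.Propositional.Properties
  using (∈-map⁺; ∈-map⁻; ∈-++⁺ˡ; ∈-++⁺ʳ; ∈-++⁻; ∈-upTo⁺; ∈-upTo⁻)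
open import Data.List.Properties using (length-map; length-++; length-upTo)
open import Data.List.Relation.Unary.All as All using (All; []; _∷_)
import Data.List.Relation.Unary.All.Properties as All
open import Data.List.Relation.Unary.AllPairs using ([]; _∷_)
open import Data.List.Relation.Unary.Any using (here; there)
open import Data.List.Relation.Unary.Unique.Propositional using (Unique)
open import Data.List.Relation.Unary.Unique.Propositional.Properties using (++⁺; upTo⁺)
open import Data.Nat using (ℕ; zero; suc; _+_; _*_; _∸_; _/_; _≤_; _<_; z≤n; s≤s; _≤?_; _<?_)
open import Data.Nat.DivMod using (m*n/n≡m)
open import Data.Nat.Properties
  using (≤-refl; ≤-reflexive; ≤-trans; ≤-antisym; ≤-pred; <-irrefl; <-asym; <-trans; <-≤-trans; ≤-<-trans;
         <⇒≤; <⇒≱; ≤⇒≯; ≮⇒≥; ≰⇒>; <-cmp; n≤1+n; m≤m+n; m≤n⇒m<n∨m≡n; m≤n⇒∃[o]m+o≡n;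
         +-monoʳ-<; +-cancelˡ-<; +-cancelˡ-≡; m+[n∸m]≡n)
open import Data.Nat.Tactic.RingSolver using (solve-∀)
open import Data.Product using (_×_; ∃-syntax; _,_; proj₁; proj₂)
open import Data.Product.Function.NonDependent.Propositional using (_×-⇔_)
open import Data.Sum using (_⊎_; inj₁; inj₂; [_,_])
open import Data.Vec using (Vec; []; _∷_; tabulate)
open import Function using (id; _∘_; _∘′_; case_of_)
open import Function.Bundles using (_⇔_; mk⇔; Equivalence)
import Function.Properties.Equivalence as ⇔
open import Relation.Binary.Definitions using (Tri; tri<; tri≈; tri>)
open import Relation.Binary.PropositionalEquality
  using (_≡_; _≢_; refl; sym; trans; cong; cong₂; subst; module ≡-Reasoning)
open import Relation.Nullary using (Dec; yes; no; does)
open import Relation.Nullary.Decidable using (dec-true; dec-false)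

open import Defs

open Equivalence using (to; from)

module _ {X : Set} where

  HasCard-resp : {P Q : X → Set} {n : ℕ} → (∀ v → P v ⇔ Q v) → HasCard P n → HasCard Q n
  HasCard-resp P⇔Q (L , unique , len , ∈⇔P) =
    L , unique , len , λ v → mk⇔ (to (P⇔Q v) ∘′ to (∈⇔P v)) (from (∈⇔P v) ∘′ from (P⇔Q v))

  HasCard-⊎ : {P Q : X → Set} {p q : ℕ} → HasCard P p → HasCard Q q → (∀ v → P v → Q v → ⊥) →
              HasCard (λ v → P v ⊎ Q v) (p + q)
  HasCard-⊎ (L , uL , refl , ∈L) (M , uM , refl , ∈M) disjoint =
    L ++ M ,
    ++⁺ uL uM (λ { {v} (v∈L , v∈M) → disjoint v (to (∈L v) v∈L) (to (∈M v) v∈M) }) ,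
    length-++ L ,
    λ v → mk⇔ ([ inj₁ ∘′ to (∈L v) , inj₂ ∘′ to (∈M v) ] ∘′ ∈-++⁻ L)
              [ ∈-++⁺ˡ ∘′ from (∈L v) , ∈-++⁺ʳ L ∘′ from (∈M v) ]

  HasCard-≡ : (z : X) → HasCard (_≡ z) 1
  HasCard-≡ z = z ∷ [] , [] ∷ [] , refl , λ v → mk⇔ (λ { (here v≡z) → v≡z ; (there ()) }) here

  module _ {Y : Set} {P : X → Set} (f : X → Y) (injective : ∀ {u v} → P u → P v → f u ≡ f v → u ≡ v) where

    map-unique : ∀ {L} → All P L → Unique L → Unique (map f L)
    map-unique [] [] = []
    map-unique (pu ∷ pL) (u∉L ∷ uL) =
      All.map⁺ (All.zipWith (λ (u≢v , pv) fu≡fv → u≢v (injective pu pv fu≡fv)) (u∉L , pL)) ∷ map-unique pL uL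

    HasCard-image : {n : ℕ} → HasCard P n → HasCard (λ y → ∃[ u ] (P u × y ≡ f u)) n
    HasCard-image (L , unique , len , ∈⇔P) =
      map f L ,
      map-unique (All.tabulate (to (∈⇔P _))) unique ,
      trans (length-map f L) len ,
      λ y → mk⇔ (λ y∈ → let (u , u∈L , y≡fu) = ∈-map⁻ f y∈ in u , to (∈⇔P u) u∈L , y≡fu)
                (λ { (u , pu , refl) → ∈-map⁺ f (from (∈⇔P u) pu) })

HasCard-< : ∀ n → HasCard (_< n) n
HasCard-< n = upTo n , upTo⁺ n , length-upTo n , λ i → mk⇔ ∈-upTo⁻ ∈-upTo⁺

Interval : ℕ → ℕ → ℕ → Set
Interval lo n c = lo ≤ c × c < lo + n

HasCard-Interval : ∀ lo n → HasCard (Interval lo n) n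
HasCard-Interval lo n = HasCard-resp shift (HasCard-image (lo +_) (λ _ _ → +-cancelˡ-≡ lo _ _) (HasCard-< n))
  where
  shift : ∀ c → (∃[ i ] (i < n × c ≡ lo + i)) ⇔ Interval lo n c
  shift c = mk⇔ (λ { (i , i<n , refl) → m≤m+n lo i , +-monoʳ-< lo i<n })
                (λ (lo≤c , c<lo+n) → let c≡lo+i = sym (m+[n∸m]≡n lo≤c) in
                   c ∸ lo , +-cancelˡ-< lo _ _ (subst (_< lo + n) c≡lo+i c<lo+n) , c≡lo+i)

Row : ℕ → ℕ → ℕ → ℕ × ℕ → Set
Row k lo n p = ∃[ l ] (Interval lo n l × p ≡ (k , l))

Column : ℕ → ℕ → ℕ → ℕ × ℕ → Set
Column l lo n p = ∃[ k ] (Interval lo n k × p ≡ (k , l))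

HasCard-Row : ∀ k lo n → HasCard (Row k lo n) n
HasCard-Row k lo n = HasCard-image (k ,_) (λ _ _ → cong proj₂) (HasCard-Interval lo n)

HasCard-Column : ∀ l lo n → HasCard (Column l lo n) n
HasCard-Column l lo n = HasCard-image (_, l) (λ _ _ → cong proj₁) (HasCard-Interval lo n)

-- ValidRange G m k l without its unused group argument.
ValidPair : ℕ → ℕ × ℕ → Set
ValidPair m (k , l) = 1 ≤ k × k < l × l ≤ suc m

ValidPair-elim : (P : ℕ → ℕ → ℕ → Set) → (∀ a' d r → P (suc (a' + d + r)) (suc a') (suc (suc a') + d)) →
                 ∀ {m a b} → ValidPair m (a , b) → P m a b
ValidPair-elim P decomposed (1≤a , a<b , b≤1+m)
  with m≤n⇒∃[o]m+o≡n 1≤a | m≤n⇒∃[o]m+o≡n a<b | m≤n⇒∃[o]m+o≡n b≤1+m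
... | a' , refl | d , refl | r , refl = decomposed a' d r

triangle : ℕ → ℕ
triangle zero    = 0
triangle (suc m) = triangle m + suc m

triangle-double : ∀ m → triangle m + triangle m ≡ m * suc m
triangle-double zero    = refl
triangle-double (suc m) = begin
  (triangle m + suc m) + (triangle m + suc m) ≡⟨ regroup (triangle m) m ⟩
  (triangle m + triangle m) + 2 * suc m       ≡⟨ cong (_+ 2 * suc m) (triangle-double m) ⟩
  m * suc m + 2 * suc m                       ≡⟨ factor m ⟩
  suc m * suc (suc m)                         ∎
  where
  open ≡-Reasoning
  regroup : ∀ t m → (t + suc m) + (t + suc m) ≡ (t + t) + 2 * suc m
  regroup = solve-∀
  factor : ∀ m → m * suc m + 2 * suc m ≡ suc m * suc (suc m)
  factor = solve-∀

triangle-half : ∀ m → m * suc m / 2 ≡ triangle m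
triangle-half m = begin
  m * suc m / 2                 ≡⟨ cong (_/ 2) (sym (triangle-double m)) ⟩
  (triangle m + triangle m) / 2 ≡⟨ cong (_/ 2) (sym (*2≡+ (triangle m))) ⟩
  triangle m * 2 / 2            ≡⟨ m*n/n≡m (triangle m) 2 ⟩
  triangle m                    ∎
  where
  open ≡-Reasoning
  *2≡+ : ∀ t → t * 2 ≡ t + t
  *2≡+ = solve-∀

HasCard-ValidPair : ∀ m → HasCard (ValidPair m) (triangle m)
HasCard-ValidPair zero =
  [] , [] , refl ,
  λ { (k , l) → mk⇔ (λ ()) λ (1≤k , k<l , l≤1) → ⊥-elim (<-irrefl refl (≤-trans (s≤s 1≤k) (≤-trans k<l l≤1))) }
HasCard-ValidPair (suc m) =
  HasCard-resp split (HasCard-⊎ (HasCard-ValidPair m) (HasCard-Column (2 + m) 1 (suc m)) disjoint)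
  where
  split : ∀ p → (ValidPair m p ⊎ Column (2 + m) 1 (suc m) p) ⇔ ValidPair (suc m) p
  split (k , l) = mk⇔ (λ { (inj₁ (1≤k , k<l , l≤1+m)) → 1≤k , k<l , ≤-trans l≤1+m (n≤1+n _)
                         ; (inj₂ (k , (1≤k , k<2+m) , refl)) → 1≤k , k<2+m , ≤-refl })
                      (λ (1≤k , k<l , l≤2+m) → [ (λ l<2+m → inj₁ (1≤k , k<l , ≤-pred l<2+m))
                                               , (λ { refl → inj₂ (k , (1≤k , k<l) , refl) }) ]
                                               (m≤n⇒m<n∨m≡n l≤2+m))
  disjoint : ∀ p → ValidPair m p → Column (2 + m) 1 (suc m) p → ⊥
  disjoint _ (_ , _ , l≤1+m) (_ , _ , refl) = <-irrefl refl l≤1+m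

module Segments (G : FiniteGroup) where

  open FiniteGroup G
  open IsGroup isGroup using (identityˡ; identityʳ; inverseʳ)

  group : Group _ _
  group = record { isGroup = isGroup }

  open GroupProperties group
    using (ε⁻¹≈ε; ⁻¹-involutive; ⁻¹-injective; ⁻¹-anti-homo-∙; inverseʳ-unique; ∙-cancelˡ; ∙-cancelʳ; x∙y⁻¹≈ε⇒x≈y)

  ⁻¹≢e : ∀ {x} → x ≢ e → x ⁻¹ ≢ e
  ⁻¹≢e x≢e x⁻¹≡e = x≢e (⁻¹-injective (trans x⁻¹≡e (sym ε⁻¹≈ε)))

  ⁻¹-square≢e : ∀ {x} → x ∙ x ≢ e → x ⁻¹ ∙ x ⁻¹ ≢ e
  ⁻¹-square≢e {x} x²≢e x⁻²≡e = ⁻¹≢e x²≢e (trans (⁻¹-anti-homo-∙ x x) x⁻²≡e)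

  square≡e⇒⁻¹≡ : ∀ {x} → x ∙ x ≡ e → x ⁻¹ ≡ x
  square≡e⇒⁻¹≡ {x} x²≡e = sym (inverseʳ-unique x x x²≡e)

  ⁻¹≡⇒square≡e : ∀ {x} → x ⁻¹ ≡ x → x ∙ x ≡ e
  ⁻¹≡⇒square≡e {x} x⁻¹≡x = trans (cong (x ∙_) (sym x⁻¹≡x)) (inverseʳ x)

  ∙e⁻¹ : ∀ u → u ∙ e ⁻¹ ≡ u
  ∙e⁻¹ u = trans (cong (u ∙_) ε⁻¹≈ε) (identityʳ u)

  pick : Bool → Carrier → Carrier
  pick c y = if c then y else e

  pick≢e⇒true : ∀ {c y} → pick c y ≢ e → c ≡ true
  pick≢e⇒true {true}  _   = refl
  pick≢e⇒true {false} e≢e = ⊥-elim (e≢e refl)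

  -- Opaque, so that unification sees inRange k l J rather than the Boolean tests inside seg.
  opaque
    inRange : ℕ → ℕ → ℕ → Bool
    inRange k l J = does (k ≤? J) ∧ does (J <? l)

    inRange-true : ∀ {k l J} → k ≤ J → J < l → inRange k l J ≡ true
    inRange-true {k} {l} {J} k≤J J<l rewrite dec-true (k ≤? J) k≤J | dec-true (J <? l) J<l = refl

    inRange-false : ∀ {k l J} → J < k ⊎ l ≤ J → inRange k l J ≡ false
    inRange-false {k} {l} {J} (inj₁ J<k) rewrite dec-false (k ≤? J) (<⇒≱ J<k) = refl
    inRange-false {k} {l} {J} (inj₂ l≤J) rewrite dec-false (J <? l) (≤⇒≯ l≤J) = ∧-zeroʳ _

    inRange-sound : ∀ {k l J} → inRange k l J ≡ true → k ≤ J × J < l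
    inRange-sound {k} {l} {J} eq with k ≤? J | J <? l
    ... | yes k≤J | yes J<l = k≤J , J<l
    ... | yes _   | no J≮l = case trans (sym eq) (inRange-false {k} {l} (inj₂ (≮⇒≥ J≮l))) of λ ()
    ... | no k≰J  | _       = case trans (sym eq) (inRange-false {k} {l} (inj₁ (≰⇒> k≰J))) of λ ()

  pick-inside : ∀ {k l J y} → k ≤ J → J < l → pick (inRange k l J) y ≡ y
  pick-inside {y = y} k≤J J<l = cong (λ c → pick c y) (inRange-true k≤J J<l)

  pick-outside : ∀ {k l J y} → J < k ⊎ l ≤ J → pick (inRange k l J) y ≡ e
  pick-outside {y = y} out = cong (λ c → pick c y) (inRange-false out)

  -- Coordinates are numbered 1, …, m as in the paper; coord returns e at 0 and beyond m.
  opaque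
    coord : ∀ {m} → Vec Carrier m → ℕ → Carrier
    coord _        zero          = e
    coord []       (suc _)       = e
    coord (u ∷ _)  (suc zero)    = u
    coord (_ ∷ us) (suc (suc J)) = coord us (suc J)

    coord-tabulate : ∀ {m} (g : ℕ → Carrier) {n} → n < m →
                     coord (tabulate {n = m} (λ j → g (suc (toℕ j)))) (suc n) ≡ g (suc n)
    coord-tabulate {suc m} g {zero}  _          = refl
    coord-tabulate {suc m} g {suc n} (s≤s n<m) = coord-tabulate (λ J → g (suc J)) n<m

    coord-beyond : ∀ {m} (v : Vec Carrier m) {n} → m ≤ n → coord v (suc n) ≡ e
    coord-beyond []       _           = refl
    coord-beyond (_ ∷ us) (s≤s m≤n) = coord-beyond us m≤n

    coord-vmul : ∀ {m} (u w : Vec Carrier m) J → coord (vmul G u w) J ≡ coord u J ∙ coord w J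
    coord-vmul _        _        zero          = sym (identityˡ e)
    coord-vmul []       []       (suc _)       = sym (identityˡ e)
    coord-vmul (_ ∷ _)  (_ ∷ _)  (suc zero)    = refl
    coord-vmul (_ ∷ us) (_ ∷ ws) (suc (suc J)) = coord-vmul us ws (suc J)

    coord-vinv : ∀ {m} (u : Vec Carrier m) J → coord (vinv G u) J ≡ coord u J ⁻¹
    coord-vinv _        zero          = sym ε⁻¹≈ε
    coord-vinv []       (suc _)       = sym ε⁻¹≈ε
    coord-vinv (_ ∷ _)  (suc zero)    = refl
    coord-vinv (_ ∷ us) (suc (suc J)) = coord-vinv us (suc J)

    coord-ext : ∀ {m} (u w : Vec Carrier m) → (∀ J → coord u J ≡ coord w J) → u ≡ w
    coord-ext []       []       _ = refl
    coord-ext (u ∷ us) (w ∷ ws) h =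
      cong₂ _∷_ (h 1) (coord-ext us ws λ { zero → refl ; (suc J) → h (suc (suc J)) })

  opaque
   unfolding inRange coord
   coord-seg : ∀ {m y k l} → ValidRange G m k l → ∀ J → coord (seg G m y k l) J ≡ pick (inRange k l J) y
   coord-seg {k = k} {l} (1≤k , _ , _) zero = sym (pick-outside {k} {l} (inj₁ 1≤k))
   coord-seg {m} {y} {k} {l} (_ , _ , l≤1+m) (suc n) with n <? m
   ... | yes n<m = coord-tabulate (λ J → pick (inRange k l J) y) n<m
   ... | no n≮m  = trans (coord-beyond (seg G m y k l) (≮⇒≥ n≮m))
                         (sym (pick-outside {k} {l} (inj₂ (≤-trans l≤1+m (s≤s (≮⇒≥ n≮m))))))


  coord-seg-inside : ∀ {m y k l J} → ValidRange G m k l → k ≤ J → J < l → coord (seg G m y k l) J ≡ y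
  coord-seg-inside kl k≤J J<l = trans (coord-seg kl _) (pick-inside k≤J J<l)

  coord-seg-support : ∀ {m y k l J} → ValidRange G m k l → coord (seg G m y k l) J ≢ e → k ≤ J × J < l
  coord-seg-support kl y≢e = inRange-sound (pick≢e⇒true (y≢e ∘ trans (coord-seg kl _)))

  segment : (m : ℕ) → Carrier → ℕ × ℕ → Vec Carrier m
  segment m y (k , l) = seg G m y k l

  seg-⊆ : ∀ {m z z' k l k' l'} → z ≢ e → ValidRange G m k l → ValidRange G m k' l' →
          seg G m z k l ≡ seg G m z' k' l' → k' ≤ k × l ≤ l'
  seg-⊆ {l = zero} _ (_ , () , _) _ _
  seg-⊆ {m} {z} {z'} {k} {suc l₀} {k'} {l'} z≢e kl@(_ , k<l , _) k'l' eq =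
    proj₁ (support ≤-refl k<l) , proj₂ (support (≤-pred k<l) ≤-refl)
    where
    support : ∀ {J} → k ≤ J → J < suc l₀ → k' ≤ J × J < l'
    support {J} k≤J J<l = coord-seg-support k'l' λ z'≡e →
      z≢e (trans (sym (coord-seg-inside kl k≤J J<l)) (trans (cong (λ v → coord v J) eq) z'≡e))

  segment-injective : ∀ {m z} → z ≢ e → ∀ {p q} → ValidPair m p → ValidPair m q →
                      segment m z p ≡ segment m z q → p ≡ q
  segment-injective z≢e {k , l} {k' , l'} kl k'l' eq =
    let k'≤k , l≤l' = seg-⊆ z≢e kl k'l' eq
        k≤k' , l'≤l = seg-⊆ z≢e k'l' kl (sym eq)
    in cong₂ _,_ (≤-antisym k≤k' k'≤k) (≤-antisym l≤l' l'≤l)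

  seg≢seg-⁻¹ : ∀ {m x k l k' l'} → x ≢ e → x ∙ x ≢ e → ValidRange G m k l → ValidRange G m k' l' →
               seg G m x k l ≢ seg G m (x ⁻¹) k' l'
  seg≢seg-⁻¹ {x = x} {k} {k' = k'} {l'} x≢e x²≢e kl@(_ , k<l , _) k'l' eq =
    differs (inRange k' l' k)
      (trans (sym (coord-seg-inside kl ≤-refl k<l)) (trans (cong (λ v → coord v k) eq) (coord-seg k'l' k)))
    where
    differs : ∀ c → x ≡ pick c (x ⁻¹) → ⊥
    differs true  x≡x⁻¹ = x²≢e (⁻¹≡⇒square≡e (sym x≡x⁻¹))
    differs false x≡e   = x≢e x≡e

  IsSegment : (m : ℕ) → Carrier → Vec Carrier m → Set
  IsSegment m y w = ∃[ p ] (ValidPair m p × w ≡ segment m y p)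

  HasCard-IsSegment : ∀ {m y} → y ≢ e → HasCard (IsSegment m y) (triangle m)
  HasCard-IsSegment {m} {y} y≢e = HasCard-image (segment m y) (segment-injective y≢e) (HasCard-ValidPair m)

  InI⇔IsSegment : ∀ {m x w} → InI G m x w ⇔ (IsSegment m x w ⊎ IsSegment m (x ⁻¹) w)
  InI⇔IsSegment = mk⇔
    (λ { (k , l , kl , inj₁ eq) → inj₁ ((k , l) , kl , eq) ; (k , l , kl , inj₂ eq) → inj₂ ((k , l) , kl , eq) })
    (λ { (inj₁ ((k , l) , kl , eq)) → k , l , kl , inj₁ eq ; (inj₂ ((k , l) , kl , eq)) → k , l , kl , inj₂ eq })

  card-I-involution : ∀ {m x} → x ≢ e → x ⁻¹ ≡ x → HasCard (InI G m x) (triangle m)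
  card-I-involution {m} {x} x≢e x⁻¹≡x =
    HasCard-resp (λ _ → mk⇔ (from InI⇔IsSegment ∘ inj₁) (merge ∘ to InI⇔IsSegment)) (HasCard-IsSegment x≢e)
    where
    merge : ∀ {w} → IsSegment m x w ⊎ IsSegment m (x ⁻¹) w → IsSegment m x w
    merge (inj₁ s)             = s
    merge (inj₂ (p , vp , eq)) = p , vp , trans eq (cong (λ y → segment m y p) x⁻¹≡x)

  card-I : ∀ {m x} → x ≢ e → x ∙ x ≢ e → HasCard (InI G m x) (triangle m + triangle m)
  card-I x≢e x²≢e =
    HasCard-resp (λ _ → ⇔.sym InI⇔IsSegment)
      (HasCard-⊎ (HasCard-IsSegment x≢e) (HasCard-IsSegment (⁻¹≢e x≢e))
        λ { _ ((k , l) , kl , refl) ((k' , l') , k'l' , eq) → seg≢seg-⁻¹ x≢e x²≢e kl k'l' eq })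

  InS-convex : ∀ {m v J₁ J₂ J₃} → InS G m v → J₁ ≤ J₂ → J₂ ≤ J₃ →
               coord v J₁ ≢ e → coord v J₃ ≢ e → coord v J₂ ≢ e
  InS-convex {J₁ = J₁} {J₂} {J₃} (y , K , L , y≢e , KL , refl) J₁≤J₂ J₂≤J₃ v₁≢e v₃≢e v₂≡e =
    y≢e (trans (sym (coord-seg-inside KL K≤J₂ J₂<L)) v₂≡e)
    where
    K≤J₂ : K ≤ J₂
    K≤J₂ = ≤-trans (proj₁ (coord-seg-support KL v₁≢e)) J₁≤J₂
    J₂<L : J₂ < L
    J₂<L = ≤-<-trans J₂≤J₃ (proj₂ (coord-seg-support KL v₃≢e))

  InS-constant : ∀ {m v J₁ J₂} → InS G m v → coord v J₁ ≢ e → coord v J₂ ≢ e → coord v J₁ ≡ coord v J₂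
  InS-constant {m} {J₁ = J₁} {J₂} (y , K , L , _ , KL , refl) v₁≢e v₂≢e =
    trans (value J₁ v₁≢e) (sym (value J₂ v₂≢e))
    where
    value : ∀ J → coord (seg G m y K L) J ≢ e → coord (seg G m y K L) J ≡ y
    value J v≢e = let K≤J , J<L = coord-seg-support {J = J} KL v≢e in coord-seg-inside {J = J} KL K≤J J<L

  InS-nontrivial : ∀ {m v} → InS G m v → ∃[ J ] coord v J ≢ e
  InS-nontrivial (y , K , L , y≢e , KL@(_ , K<L , _) , refl) =
    K , λ vK≡e → y≢e (trans (sym (coord-seg-inside KL ≤-refl K<L)) vK≡e)

  coord-difference : ∀ {m x z a b k l} → ValidRange G m a b → ValidRange G m k l → ∀ J →
    coord (vmul G (seg G m z k l) (vinv G (seg G m x a b))) J ≡ pick (inRange k l J) z ∙ pick (inRange a b J) x ⁻¹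
  coord-difference {x = x} {z} {a} {b} {k} {l} ab kl J =
    trans (coord-vmul (seg G _ z k l) _ J)
          (cong₂ _∙_ (coord-seg kl J) (trans (coord-vinv (seg G _ x a b) J) (cong _⁻¹ (coord-seg ab J))))

  Adj-intro : ∀ {m x z y a b k l K L} → y ≢ e →
    ValidRange G m a b → ValidRange G m k l → ValidRange G m K L →
    (∀ J → pick (inRange k l J) z ∙ pick (inRange a b J) x ⁻¹ ≡ pick (inRange K L J) y) →
    Adj G m (seg G m x a b) (seg G m z k l)
  Adj-intro y≢e ab kl KL difference = _ , _ , _ , y≢e , KL ,
    coord-ext _ _ λ J → trans (coord-difference ab kl J) (trans (difference J) (sym (coord-seg KL J)))

  three-parts : ∀ {p q r} → p ≤ q → q ≤ r → (P : Bool → Bool → Bool → Set) →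
    P true false true → P false true true → P false false false →
    ∀ J → P (inRange p q J) (inRange q r J) (inRange p r J)
  three-parts {p} {q} {r} p≤q q≤r P first second outside J = by-position (J <? p) (J <? q) (J <? r)
    where
    at : ∀ {c₁ c₂ c₃ d₁ d₂ d₃} → c₁ ≡ d₁ → c₂ ≡ d₂ → c₃ ≡ d₃ → P d₁ d₂ d₃ → P c₁ c₂ c₃
    at refl refl refl P-holds = P-holds
    by-position : Dec (J < p) → Dec (J < q) → Dec (J < r) → P (inRange p q J) (inRange q r J) (inRange p r J)
    by-position (yes J<p) _ _ =
      at (inRange-false (inj₁ J<p)) (inRange-false (inj₁ (<-≤-trans J<p p≤q))) (inRange-false (inj₁ J<p)) outside
    by-position (no J≮p) (yes J<q) _ =
      at (inRange-true (≮⇒≥ J≮p) J<q) (inRange-false (inj₁ J<q)) (inRange-true (≮⇒≥ J≮p) (<-≤-trans J<q q≤r)) first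
    by-position (no _) (no J≮q) (yes J<r) =
      at (inRange-false (inj₂ (≮⇒≥ J≮q))) (inRange-true (≮⇒≥ J≮q) J<r) (inRange-true (≤-trans p≤q (≮⇒≥ J≮q)) J<r) second
    by-position (no _) (no _) (no J≮r) =
      at (inRange-false (inj₂ (≤-trans q≤r (≮⇒≥ J≮r)))) (inRange-false (inj₂ (≮⇒≥ J≮r))) (inRange-false (inj₂ (≮⇒≥ J≮r))) outside

  module _ {m p q r} (1≤p : 1 ≤ p) (p<q : p < q) (q<r : q < r) (r≤1+m : r ≤ suc m) where

    private
      pq : ValidRange G m p q
      pq = 1≤p , p<q , <⇒≤ (<-≤-trans q<r r≤1+m)
      qr : ValidRange G m q r
      qr = ≤-trans 1≤p (<⇒≤ p<q) , q<r , r≤1+m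
      pr : ValidRange G m p r
      pr = 1≤p , <-trans p<q q<r , r≤1+m
      split : (P : Bool → Bool → Bool → Set) → P true false true → P false true true → P false false false →
              ∀ J → P (inRange p q J) (inRange q r J) (inRange p r J)
      split = three-parts (<⇒≤ p<q) (<⇒≤ q<r)

    Adj-shrink-end : ∀ {x} → x ≢ e → Adj G m (seg G m x p r) (seg G m x p q)
    Adj-shrink-end {x} x≢e = Adj-intro (⁻¹≢e x≢e) pr pq qr
      (split (λ α β γ → pick α x ∙ pick γ x ⁻¹ ≡ pick β (x ⁻¹)) (inverseʳ x) (identityˡ _) (∙e⁻¹ e))

    Adj-grow-end : ∀ {x} → x ≢ e → Adj G m (seg G m x p q) (seg G m x p r)
    Adj-grow-end {x} x≢e = Adj-intro x≢e pq pr qr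
      (split (λ α β γ → pick γ x ∙ pick α x ⁻¹ ≡ pick β x) (inverseʳ x) (∙e⁻¹ x) (∙e⁻¹ e))

    Adj-shrink-start : ∀ {x} → x ≢ e → Adj G m (seg G m x p r) (seg G m x q r)
    Adj-shrink-start {x} x≢e = Adj-intro (⁻¹≢e x≢e) pr qr pq
      (split (λ α β γ → pick β x ∙ pick γ x ⁻¹ ≡ pick α (x ⁻¹)) (identityˡ _) (inverseʳ x) (∙e⁻¹ e))

    Adj-grow-start : ∀ {x} → x ≢ e → Adj G m (seg G m x q r) (seg G m x p r)
    Adj-grow-start {x} x≢e = Adj-intro x≢e qr pr pq
      (split (λ α β γ → pick γ x ∙ pick β x ⁻¹ ≡ pick α x) (∙e⁻¹ x) (inverseʳ x) (∙e⁻¹ e))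

    Adj-precede : ∀ {x z} → z ≢ e → x ⁻¹ ≡ z → Adj G m (seg G m x q r) (seg G m z p q)
    Adj-precede {x} {z} z≢e x⁻¹≡z = Adj-intro z≢e qr pq pr
      (split (λ α β γ → pick α z ∙ pick β x ⁻¹ ≡ pick γ z) (∙e⁻¹ z) (trans (identityˡ _) x⁻¹≡z) (∙e⁻¹ e))

    Adj-follow : ∀ {x z} → z ≢ e → x ⁻¹ ≡ z → Adj G m (seg G m x p q) (seg G m z q r)
    Adj-follow {x} {z} z≢e x⁻¹≡z = Adj-intro z≢e pq qr pr
      (split (λ α β γ → pick β z ∙ pick α x ⁻¹ ≡ pick γ z) (trans (identityˡ _) x⁻¹≡z) (∙e⁻¹ z) (∙e⁻¹ e))

  Adj-invert : ∀ {m x a b} → x ⁻¹ ∙ x ⁻¹ ≢ e → ValidRange G m a b → Adj G m (seg G m x a b) (seg G m (x ⁻¹) a b)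
  Adj-invert {x = x} {a} {b} x⁻²≢e ab = Adj-intro x⁻²≢e ab ab ab λ J → pointwise (inRange a b J)
    where
    pointwise : ∀ c → pick c (x ⁻¹) ∙ pick c x ⁻¹ ≡ pick c (x ⁻¹ ∙ x ⁻¹)
    pointwise true  = refl
    pointwise false = ∙e⁻¹ e

  module Overlap {m x z a b k l} (ab : ValidRange G m a b) (kl : ValidRange G m k l)
                 (adjacent : Adj G m (seg G m x a b) (seg G m z k l)) where

    δ : ℕ → Carrier
    δ = coord (vmul G (seg G m z k l) (vinv G (seg G m x a b)))

    private
      δ-at : ∀ {J c d} → inRange k l J ≡ c → inRange a b J ≡ d → δ J ≡ pick c z ∙ pick d x ⁻¹
      δ-at {J} kl≡c ab≡d =
        trans (coord-difference ab kl J) (cong₂ (λ c d → pick c z ∙ pick d x ⁻¹) kl≡c ab≡d)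

    only-kl : ∀ {J} → k ≤ J → J < l → J < a ⊎ b ≤ J → δ J ≡ z
    only-kl k≤J J<l out = trans (δ-at (inRange-true k≤J J<l) (inRange-false out)) (∙e⁻¹ z)

    only-ab : ∀ {J} → J < k ⊎ l ≤ J → a ≤ J → J < b → δ J ≡ x ⁻¹
    only-ab out a≤J J<b = trans (δ-at (inRange-false out) (inRange-true a≤J J<b)) (identityˡ _)

    in-both : ∀ {J} → k ≤ J → J < l → a ≤ J → J < b → δ J ≡ z ∙ x ⁻¹
    in-both k≤J J<l a≤J J<b = δ-at (inRange-true k≤J J<l) (inRange-true a≤J J<b)

    in-neither : ∀ {J} → J < k ⊎ l ≤ J → J < a ⊎ b ≤ J → δ J ≡ e
    in-neither out₁ out₂ = trans (δ-at (inRange-false out₁) (inRange-false out₂)) (∙e⁻¹ e)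

    same-ranges : k ≡ a → l ≡ b → ∀ J → δ J ≡ pick (inRange a b J) z ∙ pick (inRange a b J) x ⁻¹
    same-ranges k≡a l≡b J = δ-at (cong₂ (λ k l → inRange k l J) k≡a l≡b) refl

    ≢e-by : ∀ {J u} → δ J ≡ u → u ≢ e → δ J ≢ e
    ≢e-by δJ≡u u≢e δJ≡e = u≢e (trans (sym δJ≡u) δJ≡e)

    gap : ∀ {J₁ J₂ J₃} → J₁ ≤ J₂ → J₂ ≤ J₃ → δ J₁ ≢ e → δ J₂ ≡ e → δ J₃ ≢ e → ⊥
    gap J₁≤J₂ J₂≤J₃ δ₁≢e δ₂≡e δ₃≢e = InS-convex adjacent J₁≤J₂ J₂≤J₃ δ₁≢e δ₃≢e δ₂≡e

    equal-values : ∀ {J₁ J₂ u₁ u₂} → δ J₁ ≡ u₁ → δ J₂ ≡ u₂ → u₁ ≢ e → u₂ ≢ e → u₁ ≡ u₂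
    equal-values δ₁ δ₂ u₁≢e u₂≢e =
      trans (sym δ₁) (trans (InS-constant adjacent (≢e-by δ₁ u₁≢e) (≢e-by δ₂ u₂≢e)) δ₂)

  SharesOneEndpoint : ℕ → ℕ → ℕ → ℕ → Set
  SharesOneEndpoint a b k l = (k ≡ a × l < b) ⊎ (k ≡ a × b < l) ⊎ (l ≡ b × k < a) ⊎ (l ≡ b × a < k)

  Abut : ℕ → ℕ → ℕ → ℕ → Set
  Abut a b k l = l ≡ a ⊎ k ≡ b

  neighbour-with-same-value : ∀ {m x a b k l} → x ≢ e → ValidRange G m a b → ValidRange G m k l →
    Adj G m (seg G m x a b) (seg G m x k l) → SharesOneEndpoint a b k l ⊎ (Abut a b k l × x ⁻¹ ≡ x)
  neighbour-with-same-value {x = x} {a} {b} {k} {l} x≢e ab@(_ , a<b , _) kl@(_ , k<l , _) adjacent = by-start (<-cmp k a)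
    where
    open Overlap ab kl adjacent

    Result : Set
    Result = SharesOneEndpoint a b k l ⊎ (Abut a b k l × x ⁻¹ ≡ x)

    kl-only : ∀ {J} → k ≤ J → J < l → J < a ⊎ b ≤ J → δ J ≢ e
    kl-only k≤J J<l out = ≢e-by (only-kl k≤J J<l out) x≢e

    ab-only : ∀ {J} → J < k ⊎ l ≤ J → a ≤ J → J < b → δ J ≢ e
    ab-only out a≤J J<b = ≢e-by (only-ab out a≤J J<b) (⁻¹≢e x≢e)

    both : ∀ {J} → k ≤ J → J < l → a ≤ J → J < b → δ J ≡ e
    both k≤J J<l a≤J J<b = trans (in-both k≤J J<l a≤J J<b) (inverseʳ x)

    cancels : ∀ c → pick c x ∙ pick c x ⁻¹ ≡ e
    cancels true  = inverseʳ x
    cancels false = ∙e⁻¹ e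

    starts-before : k < a → Tri (l < a) (l ≡ a) (a < l) → Result
    starts-before k<a (tri< l<a _ _) = ⊥-elim (gap (<⇒≤ k<l) (<⇒≤ l<a)
      (kl-only ≤-refl k<l (inj₁ k<a)) (in-neither (inj₂ ≤-refl) (inj₁ l<a)) (ab-only (inj₂ (<⇒≤ l<a)) ≤-refl a<b))
    starts-before k<a (tri≈ _ l≡a _) = inj₂ (inj₁ l≡a ,
      equal-values (only-ab (inj₂ (≤-reflexive l≡a)) ≤-refl a<b) (only-kl ≤-refl k<l (inj₁ k<a)) (⁻¹≢e x≢e) x≢e)
    starts-before k<a (tri> _ _ a<l) = ends (<-cmp l b)
      where
      ends : Tri (l < b) (l ≡ b) (b < l) → Result
      ends (tri< l<b _ _) = ⊥-elim (gap (<⇒≤ k<a) (<⇒≤ a<l)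
        (kl-only ≤-refl k<l (inj₁ k<a)) (both (<⇒≤ k<a) a<l ≤-refl a<b) (ab-only (inj₂ ≤-refl) (<⇒≤ a<l) l<b))
      ends (tri≈ _ l≡b _) = inj₁ (inj₂ (inj₂ (inj₁ (l≡b , k<a))))
      ends (tri> _ _ b<l) = ⊥-elim (gap (<⇒≤ k<a) (<⇒≤ a<b)
        (kl-only ≤-refl k<l (inj₁ k<a)) (both (<⇒≤ k<a) a<l ≤-refl a<b) (kl-only (<⇒≤ (<-trans k<a a<b)) b<l (inj₂ ≤-refl)))

    starts-with : k ≡ a → Tri (l < b) (l ≡ b) (b < l) → Result
    starts-with k≡a (tri< l<b _ _) = inj₁ (inj₁ (k≡a , l<b))
    starts-with k≡a (tri≈ _ l≡b _) =
      let J , δJ≢e = InS-nontrivial adjacent in ⊥-elim (δJ≢e (trans (same-ranges k≡a l≡b J) (cancels (inRange a b J))))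
    starts-with k≡a (tri> _ _ b<l) = inj₁ (inj₂ (inj₁ (k≡a , b<l)))

    starts-after : a < k → Tri (k < b) (k ≡ b) (b < k) → Result
    starts-after a<k (tri< k<b _ _) = ends (<-cmp l b)
      where
      ends : Tri (l < b) (l ≡ b) (b < l) → Result
      ends (tri< l<b _ _) = ⊥-elim (gap (<⇒≤ a<k) (<⇒≤ k<l)
        (ab-only (inj₁ a<k) ≤-refl a<b) (both ≤-refl k<l (<⇒≤ a<k) k<b) (ab-only (inj₂ ≤-refl) (<⇒≤ (<-trans a<k k<l)) l<b))
      ends (tri≈ _ l≡b _) = inj₁ (inj₂ (inj₂ (inj₂ (l≡b , a<k))))
      ends (tri> _ _ b<l) = ⊥-elim (gap (<⇒≤ a<k) (<⇒≤ k<b)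
        (ab-only (inj₁ a<k) ≤-refl a<b) (both ≤-refl k<l (<⇒≤ a<k) k<b) (kl-only (<⇒≤ k<b) b<l (inj₂ ≤-refl)))
    starts-after a<k (tri≈ _ k≡b _) = inj₂ (inj₂ k≡b ,
      equal-values (only-ab (inj₁ a<k) ≤-refl a<b) (only-kl ≤-refl k<l (inj₂ (≤-reflexive (sym k≡b)))) (⁻¹≢e x≢e) x≢e)
    starts-after a<k (tri> _ _ b<k) = ⊥-elim (gap (<⇒≤ a<b) (<⇒≤ b<k)
      (ab-only (inj₁ (<-trans a<b b<k)) ≤-refl a<b) (in-neither (inj₁ b<k) (inj₂ ≤-refl)) (kl-only ≤-refl k<l (inj₂ (<⇒≤ b<k))))

    by-start : Tri (k < a) (k ≡ a) (a < k) → Result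
    by-start (tri< k<a _ _) = starts-before k<a (<-cmp l a)
    by-start (tri≈ _ k≡a _) = starts-with k≡a (<-cmp l b)
    by-start (tri> _ _ a<k) = starts-after a<k (<-cmp k b)

  neighbour-with-other-value : ∀ {m x z a b k l} → x ≢ e → z ≢ e → z ≢ x → ValidRange G m a b → ValidRange G m k l →
    Adj G m (seg G m x a b) (seg G m z k l) → (k ≡ a × l ≡ b) ⊎ Abut a b k l
  neighbour-with-other-value {x = x} {z} {a} {b} {k} {l} x≢e z≢e z≢x ab@(_ , a<b , _) kl@(_ , k<l , _) adjacent =
    by-start (<-cmp k a)
    where
    open Overlap ab kl adjacent

    Result : Set
    Result = (k ≡ a × l ≡ b) ⊎ Abut a b k l

    zx⁻¹≢e : z ∙ x ⁻¹ ≢ e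
    zx⁻¹≢e = z≢x ∘ x∙y⁻¹≈ε⇒x≈y z x

    kl-only : ∀ {J} → k ≤ J → J < l → J < a ⊎ b ≤ J → δ J ≢ e
    kl-only k≤J J<l out = ≢e-by (only-kl k≤J J<l out) z≢e

    ab-only : ∀ {J} → J < k ⊎ l ≤ J → a ≤ J → J < b → δ J ≢ e
    ab-only out a≤J J<b = ≢e-by (only-ab out a≤J J<b) (⁻¹≢e x≢e)

    both-vs-kl : ∀ {J₁ J₂} → k ≤ J₁ → J₁ < l → a ≤ J₁ → J₁ < b → k ≤ J₂ → J₂ < l → J₂ < a ⊎ b ≤ J₂ → ⊥
    both-vs-kl k≤J₁ J₁<l a≤J₁ J₁<b k≤J₂ J₂<l out =
      ⁻¹≢e x≢e (∙-cancelˡ z _ _ (trans (equal-values (in-both k≤J₁ J₁<l a≤J₁ J₁<b) (only-kl k≤J₂ J₂<l out) zx⁻¹≢e z≢e)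
                                      (sym (identityʳ z))))

    both-vs-ab : ∀ {J₁ J₂} → k ≤ J₁ → J₁ < l → a ≤ J₁ → J₁ < b → J₂ < k ⊎ l ≤ J₂ → a ≤ J₂ → J₂ < b → ⊥
    both-vs-ab k≤J₁ J₁<l a≤J₁ J₁<b out a≤J₂ J₂<b =
      z≢e (∙-cancelʳ (x ⁻¹) _ _ (trans (equal-values (in-both k≤J₁ J₁<l a≤J₁ J₁<b) (only-ab out a≤J₂ J₂<b) zx⁻¹≢e (⁻¹≢e x≢e))
                                       (sym (identityˡ _))))

    starts-before : k < a → Tri (l < a) (l ≡ a) (a < l) → Result
    starts-before k<a (tri< l<a _ _) = ⊥-elim (gap (<⇒≤ k<l) (<⇒≤ l<a)
      (kl-only ≤-refl k<l (inj₁ k<a)) (in-neither (inj₂ ≤-refl) (inj₁ l<a)) (ab-only (inj₂ (<⇒≤ l<a)) ≤-refl a<b))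
    starts-before k<a (tri≈ _ l≡a _) = inj₂ (inj₁ l≡a)
    starts-before k<a (tri> _ _ a<l) = ⊥-elim (both-vs-kl (<⇒≤ k<a) a<l ≤-refl a<b ≤-refl k<l (inj₁ k<a))

    starts-with : k ≡ a → Tri (l < b) (l ≡ b) (b < l) → Result
    starts-with k≡a (tri< l<b _ _) =
      ⊥-elim (both-vs-ab (≤-reflexive k≡a) a<l ≤-refl a<b (inj₂ ≤-refl) (<⇒≤ a<l) l<b)
      where
      a<l : a < l
      a<l = subst (_< l) k≡a k<l
    starts-with k≡a (tri≈ _ l≡b _) = inj₁ (k≡a , l≡b)
    starts-with k≡a (tri> _ _ b<l) =
      ⊥-elim (both-vs-kl (≤-reflexive k≡a) (subst (_< l) k≡a k<l) ≤-refl a<b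
                         (≤-trans (≤-reflexive k≡a) (<⇒≤ a<b)) b<l (inj₂ ≤-refl))

    starts-after : a < k → Tri (k < b) (k ≡ b) (b < k) → Result
    starts-after a<k (tri< k<b _ _) = ⊥-elim (both-vs-ab ≤-refl k<l (<⇒≤ a<k) k<b (inj₁ a<k) ≤-refl a<b)
    starts-after a<k (tri≈ _ k≡b _) = inj₂ (inj₂ k≡b)
    starts-after a<k (tri> _ _ b<k) = ⊥-elim (gap (<⇒≤ a<b) (<⇒≤ b<k)
      (ab-only (inj₁ (<-trans a<b b<k)) ≤-refl a<b) (in-neither (inj₁ b<k) (inj₂ ≤-refl)) (kl-only ≤-refl k<l (inj₂ (<⇒≤ b<k))))

    by-start : Tri (k < a) (k ≡ a) (a < k) → Result
    by-start (tri< k<a _ _) = starts-before k<a (<-cmp l a)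
    by-start (tri≈ _ k≡a _) = starts-with k≡a (<-cmp l b)
    by-start (tri> _ _ a<k) = starts-after a<k (<-cmp k b)

  -- The vertex x_[a,b), where a' = a − 1, d = b − a − 1 and r = m + 1 − b count the positions
  -- before a, strictly between a and b, and from b on.  Resized: x_[a,l) and x_[k,b) with
  -- (k,l) ≠ (a,b); Abutting: the intervals [k,a) and [b,l).
  module Neighbours {x : Carrier} (x≢e : x ≢ e) (a' d r : ℕ) where

    a b m : ℕ
    a = suc a'
    b = suc a + d
    m = suc (a' + d + r)

    private
      1≤a : 1 ≤ a
      1≤a = s≤s z≤n
      a<b : a < b
      a<b = m≤m+n (suc a) d
      b≤1+m : b ≤ suc m
      b≤1+m = m≤m+n b r
      a≢b : a ≢ b
      a≢b a≡b = <-irrefl a≡b a<b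

    vertex : Vec Carrier m
    vertex = seg G m x a b

    vertex-valid : ValidRange G m a b
    vertex-valid = 1≤a , a<b , b≤1+m

    Resized : ℕ × ℕ → Set
    Resized p = Row a (suc a) d p ⊎ Row a (suc b) r p ⊎ Column b 1 a' p ⊎ Column b (suc a) d p

    Abutting : ℕ × ℕ → Set
    Abutting p = Column a 1 a' p ⊎ Row b (suc b) r p

    HasCard-Resized : HasCard Resized (d + (r + (a' + d)))
    HasCard-Resized =
      HasCard-⊎ (HasCard-Row a (suc a) d)
        (HasCard-⊎ (HasCard-Row a (suc b) r)
          (HasCard-⊎ (HasCard-Column b 1 a') (HasCard-Column b (suc a) d)
            λ { _ (_ , (_ , c<a) , refl) (_ , (a<c , _) , refl) → <-asym c<a a<c })
          λ { _ (_ , (b<b , _) , refl) (inj₁ (_ , _ , refl)) → <-irrefl refl b<b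
            ; _ (_ , (b<b , _) , refl) (inj₂ (_ , _ , refl)) → <-irrefl refl b<b })
        λ { _ (_ , (_ , c<b) , refl) (inj₁ (_ , (b<c , _) , refl)) → <-asym c<b b<c
          ; _ (_ , (_ , b<b) , refl) (inj₂ (inj₁ (_ , _ , refl))) → <-irrefl refl b<b
          ; _ (_ , (_ , b<b) , refl) (inj₂ (inj₂ (_ , _ , refl))) → <-irrefl refl b<b }

    HasCard-Abutting : HasCard Abutting (a' + r)
    HasCard-Abutting = HasCard-⊎ (HasCard-Column a 1 a') (HasCard-Row b (suc b) r)
      λ { _ (_ , _ , refl) (_ , (b<a , _) , refl) → <-asym a<b b<a }

    Resized∩Abutting≡∅ : ∀ p → Resized p → Abutting p → ⊥
    Resized∩Abutting≡∅ _ (inj₁ (_ , (a<a , _) , refl)) (inj₁ (_ , _ , refl)) = <-irrefl refl a<a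
    Resized∩Abutting≡∅ _ (inj₁ (_ , _ , refl)) (inj₂ (_ , _ , eq)) = a≢b (cong proj₁ eq)
    Resized∩Abutting≡∅ _ (inj₂ (inj₁ (_ , (b<a , _) , refl))) (inj₁ (_ , _ , refl)) = <-asym a<b b<a
    Resized∩Abutting≡∅ _ (inj₂ (inj₁ (_ , _ , refl))) (inj₂ (_ , _ , eq)) = a≢b (cong proj₁ eq)
    Resized∩Abutting≡∅ _ (inj₂ (inj₂ (inj₁ (_ , _ , refl)))) (inj₁ (_ , _ , eq)) = a≢b (sym (cong proj₂ eq))
    Resized∩Abutting≡∅ _ (inj₂ (inj₂ (inj₁ (_ , (_ , b<a) , refl)))) (inj₂ (_ , _ , refl)) = <-asym a<b b<a
    Resized∩Abutting≡∅ _ (inj₂ (inj₂ (inj₂ (_ , _ , refl)))) (inj₁ (_ , _ , eq)) = a≢b (sym (cong proj₂ eq))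
    Resized∩Abutting≡∅ _ (inj₂ (inj₂ (inj₂ (_ , (_ , b<b) , refl)))) (inj₂ (_ , _ , refl)) = <-irrefl refl b<b

    Resized⇒valid : ∀ {p} → Resized p → ValidPair m p
    Resized⇒valid (inj₁ (_ , (a<l , l<b) , refl)) = 1≤a , a<l , ≤-trans (<⇒≤ l<b) b≤1+m
    Resized⇒valid (inj₂ (inj₁ (_ , (b<l , l<2+m) , refl))) = 1≤a , <-trans a<b b<l , ≤-pred l<2+m
    Resized⇒valid (inj₂ (inj₂ (inj₁ (_ , (1≤k , k<a) , refl)))) = 1≤k , <-trans k<a a<b , b≤1+m
    Resized⇒valid (inj₂ (inj₂ (inj₂ (_ , (a<k , k<b) , refl)))) = ≤-trans 1≤a (<⇒≤ a<k) , k<b , b≤1+m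

    Abutting⇒valid : ∀ {p} → Abutting p → ValidPair m p
    Abutting⇒valid (inj₁ (_ , (1≤k , k<a) , refl)) = 1≤k , k<a , ≤-trans (<⇒≤ a<b) b≤1+m
    Abutting⇒valid (inj₂ (_ , (b<l , l<2+m) , refl)) = ≤-trans 1≤a (<⇒≤ a<b) , b<l , ≤-pred l<2+m

    Resized⇒Adj : ∀ {p} → Resized p → Adj G m vertex (segment m x p)
    Resized⇒Adj (inj₁ (_ , (a<l , l<b) , refl)) = Adj-shrink-end 1≤a a<l l<b b≤1+m x≢e
    Resized⇒Adj (inj₂ (inj₁ (_ , (b<l , l<2+m) , refl))) = Adj-grow-end 1≤a a<b b<l (≤-pred l<2+m) x≢e
    Resized⇒Adj (inj₂ (inj₂ (inj₁ (_ , (1≤k , k<a) , refl)))) = Adj-grow-start 1≤k k<a a<b b≤1+m x≢e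
    Resized⇒Adj (inj₂ (inj₂ (inj₂ (_ , (a<k , k<b) , refl)))) = Adj-shrink-start 1≤a a<k k<b b≤1+m x≢e

    Abutting⇒Adj : ∀ {z p} → z ≢ e → x ⁻¹ ≡ z → Abutting p → Adj G m vertex (segment m z p)
    Abutting⇒Adj z≢e x⁻¹≡z (inj₁ (_ , (1≤k , k<a) , refl)) = Adj-precede 1≤k k<a a<b b≤1+m z≢e x⁻¹≡z
    Abutting⇒Adj z≢e x⁻¹≡z (inj₂ (_ , (b<l , l<2+m) , refl)) = Adj-follow 1≤a a<b b<l (≤-pred l<2+m) z≢e x⁻¹≡z

    Resized-of : ∀ {k l} → ValidRange G m k l → SharesOneEndpoint a b k l → Resized (k , l)
    Resized-of (_ , k<l , _) (inj₁ (k≡a , l<b)) = inj₁ (_ , (subst (_< _) k≡a k<l , l<b) , cong (_, _) k≡a)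
    Resized-of (_ , _ , l≤1+m) (inj₂ (inj₁ (k≡a , b<l))) = inj₂ (inj₁ (_ , (b<l , s≤s l≤1+m) , cong (_, _) k≡a))
    Resized-of (1≤k , _ , _) (inj₂ (inj₂ (inj₁ (l≡b , k<a)))) = inj₂ (inj₂ (inj₁ (_ , (1≤k , k<a) , cong (_ ,_) l≡b)))
    Resized-of (_ , k<l , _) (inj₂ (inj₂ (inj₂ (l≡b , a<k)))) =
      inj₂ (inj₂ (inj₂ (_ , (a<k , subst (_ <_) l≡b k<l) , cong (_ ,_) l≡b)))

    Abutting-of : ∀ {k l} → ValidRange G m k l → Abut a b k l → Abutting (k , l)
    Abutting-of (1≤k , k<l , _) (inj₁ l≡a) = inj₁ (_ , (1≤k , subst (_ <_) l≡a k<l) , cong (_ ,_) l≡a)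
    Abutting-of (_ , k<l , l≤1+m) (inj₂ k≡b) = inj₂ (_ , (subst (_< _) k≡b k<l , s≤s l≤1+m) , cong (_, _) k≡b)

    private
      double : ∀ n → suc (suc (n + n)) ≡ 2 * suc n
      double = solve-∀
      regroup : ∀ a' d r → d + (r + (a' + d)) + (a' + r) ≡ (a' + d + r) + (a' + d + r)
      regroup = solve-∀
      regroup-suc : ∀ a' d r → d + (r + (a' + d)) + (1 + (a' + r)) ≡ suc ((a' + d + r) + (a' + d + r))
      regroup-suc = solve-∀

    neighbourhood-involution : x ⁻¹ ≡ x → HasCard (λ w → InI G m x w × Adj G m vertex w) (2 * m ∸ 2)
    neighbourhood-involution x⁻¹≡x =
      subst (HasCard _) (trans (regroup a' d r) (cong (_∸ 2) (double (a' + d + r))))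
        (HasCard-resp (λ _ → mk⇔ to′ from′)
          (HasCard-image (segment m x) (λ cu cv → segment-injective x≢e (valid cu) (valid cv))
            (HasCard-⊎ HasCard-Resized HasCard-Abutting Resized∩Abutting≡∅)))
      where
      valid : ∀ {p} → Resized p ⊎ Abutting p → ValidPair m p
      valid = [ Resized⇒valid , Abutting⇒valid ]

      to′ : ∀ {w} → ∃[ p ] ((Resized p ⊎ Abutting p) × w ≡ segment m x p) → InI G m x w × Adj G m vertex w
      to′ ((k , l) , c , refl) = (k , l , valid c , inj₁ refl) , [ Resized⇒Adj , Abutting⇒Adj x≢e x⁻¹≡x ] c

      classify : ∀ {k l} → ValidRange G m k l → Adj G m vertex (seg G m x k l) → Resized (k , l) ⊎ Abutting (k , l)
      classify kl adjacent =
        [ inj₁ ∘ Resized-of kl , inj₂ ∘ Abutting-of kl ∘ proj₁ ] (neighbour-with-same-value x≢e vertex-valid kl adjacent)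

      from′ : ∀ {w} → InI G m x w × Adj G m vertex w → ∃[ p ] ((Resized p ⊎ Abutting p) × w ≡ segment m x p)
      from′ ((k , l , kl , inj₁ refl) , adjacent) = (k , l) , classify kl adjacent , refl
      from′ ((k , l , kl , inj₂ refl) , adjacent) =
        (k , l) , classify kl (subst (λ y → Adj G m vertex (seg G m y k l)) x⁻¹≡x adjacent) ,
        cong (λ y → seg G m y k l) x⁻¹≡x

    neighbourhood : x ∙ x ≢ e → HasCard (λ w → InI G m x w × Adj G m vertex w) (2 * m ∸ 1)
    neighbourhood x²≢e =
      subst (HasCard _) (trans (regroup-suc a' d r) (cong (_∸ 1) (double (a' + d + r))))
        (HasCard-resp (λ _ → mk⇔ to′ from′)
          (HasCard-⊎
            (HasCard-image (segment m x) (λ cu cv → segment-injective x≢e (Resized⇒valid cu) (Resized⇒valid cv))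
              HasCard-Resized)
            (HasCard-image (segment m (x ⁻¹)) (λ cu cv → segment-injective (⁻¹≢e x≢e) (valid cu) (valid cv))
              (HasCard-⊎ (HasCard-≡ (a , b)) HasCard-Abutting vertex∉Abutting))
            λ { _ ((k , l) , c , refl) (_ , c′ , eq) → seg≢seg-⁻¹ x≢e x²≢e (Resized⇒valid c) (valid c′) eq }))
      where
      Inverted : ℕ × ℕ → Set
      Inverted p = p ≡ (a , b) ⊎ Abutting p

      vertex∉Abutting : ∀ p → p ≡ (a , b) → Abutting p → ⊥
      vertex∉Abutting _ refl (inj₁ (_ , _ , eq)) = a≢b (sym (cong proj₂ eq))
      vertex∉Abutting _ refl (inj₂ (_ , _ , eq)) = a≢b (cong proj₁ eq)

      valid : ∀ {p} → Inverted p → ValidPair m p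
      valid (inj₁ refl) = vertex-valid
      valid (inj₂ c)    = Abutting⇒valid c

      Inverted⇒Adj : ∀ {p} → Inverted p → Adj G m vertex (segment m (x ⁻¹) p)
      Inverted⇒Adj (inj₁ refl) = Adj-invert (⁻¹-square≢e x²≢e) vertex-valid
      Inverted⇒Adj (inj₂ c)    = Abutting⇒Adj (⁻¹≢e x≢e) refl c

      Neighbour : Vec Carrier m → Set
      Neighbour w = (∃[ p ] (Resized p × w ≡ segment m x p)) ⊎ (∃[ p ] (Inverted p × w ≡ segment m (x ⁻¹) p))

      to′ : ∀ {w} → Neighbour w → InI G m x w × Adj G m vertex w
      to′ (inj₁ ((k , l) , c , refl)) = (k , l , Resized⇒valid c , inj₁ refl) , Resized⇒Adj c
      to′ (inj₂ ((k , l) , c , refl)) = (k , l , valid c , inj₂ refl) , Inverted⇒Adj c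

      from′ : ∀ {w} → InI G m x w × Adj G m vertex w → Neighbour w
      from′ ((k , l , kl , inj₁ refl) , adjacent) =
        inj₁ ((k , l) , [ Resized-of kl , (λ (_ , x⁻¹≡x) → ⊥-elim (x²≢e (⁻¹≡⇒square≡e x⁻¹≡x))) ]
                          (neighbour-with-same-value x≢e vertex-valid kl adjacent) , refl)
      from′ ((k , l , kl , inj₂ refl) , adjacent) =
        inj₂ ((k , l) , [ (λ (k≡a , l≡b) → inj₁ (cong₂ _,_ k≡a l≡b)) , inj₂ ∘ Abutting-of kl ]
                          (neighbour-with-other-value x≢e (⁻¹≢e x≢e) (x²≢e ∘ ⁻¹≡⇒square≡e) vertex-valid kl adjacent) , refl)

  InI-⁻¹ : ∀ {m x w} → InI G m (x ⁻¹) w ⇔ InI G m x w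
  InI-⁻¹ {m} {x} = mk⇔
    (λ { (k , l , kl , inj₁ eq) → k , l , kl , inj₂ eq
       ; (k , l , kl , inj₂ eq) → k , l , kl , inj₁ (trans eq (cong (λ y → seg G m y k l) (⁻¹-involutive x))) })
    (λ { (k , l , kl , inj₁ eq) → k , l , kl , inj₂ (trans eq (cong (λ y → seg G m y k l) (sym (⁻¹-involutive x))))
       ; (k , l , kl , inj₂ eq) → k , l , kl , inj₁ eq })

  Neighbourhood : ∀ m → Carrier → Vec Carrier m → ℕ → Set
  Neighbourhood m x v = HasCard (λ w → InI G m x w × Adj G m v w)

  regular-involution : ∀ {m x} → x ≢ e → x ⁻¹ ≡ x → IsRegularI G m x (2 * m ∸ 2)
  regular-involution {m} {x} x≢e x⁻¹≡x v (a , b , ab , v≡) =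
    subst (λ v → Neighbourhood m x v (2 * m ∸ 2)) (sym ([ id , (λ eq → trans eq (cong (λ y → seg G m y a b) x⁻¹≡x)) ] v≡))
      (ValidPair-elim (λ m a b → Neighbourhood m x (seg G m x a b) (2 * m ∸ 2))
        (λ a' d r → Neighbours.neighbourhood-involution x≢e a' d r x⁻¹≡x) ab)

  regular : ∀ {m x} → x ≢ e → x ∙ x ≢ e → IsRegularI G m x (2 * m ∸ 1)
  regular {m} {x} x≢e x²≢e _ (a , b , ab , inj₁ refl) =
    ValidPair-elim (λ m a b → Neighbourhood m x (seg G m x a b) (2 * m ∸ 1))
      (λ a' d r → Neighbours.neighbourhood x≢e a' d r x²≢e) ab
  regular {m} {x} x≢e x²≢e _ (a , b , ab , inj₂ refl) =
    HasCard-resp (λ _ → InI-⁻¹ ×-⇔ ⇔.refl)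
      (ValidPair-elim (λ m a b → Neighbourhood m (x ⁻¹) (seg G m (x ⁻¹) a b) (2 * m ∸ 1))
        (λ a' d r → Neighbours.neighbourhood (⁻¹≢e x≢e) a' d r (⁻¹-square≢e x²≢e)) ab)

lemma4p1 : (G : FiniteGroup) → 1 < FiniteGroup.size G →
    (x : FiniteGroup.Carrier G) → x ≢ FiniteGroup.e G →
    (m : ℕ) → 1 < m →
    (HasOrder G x 2 → CardI G m x ((m * suc m) / 2) × IsRegularI G m x (2 * m ∸ 2))
    × (∀ k → 2 < k → HasOrder G x k → CardI G m x (m * suc m) × IsRegularI G m x (2 * m ∸ 1))
lemma4p1 G _ x x≢e m _ = order-two , order-above-two
  where
  open FiniteGroup G
  open IsGroup isGroup using (identityʳ)
  open Segments G

  x²≡pow2 : x ∙ x ≡ pow G x 2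
  x²≡pow2 = cong (x ∙_) (sym (identityʳ x))

  order-two : HasOrder G x 2 → CardI G m x ((m * suc m) / 2) × IsRegularI G m x (2 * m ∸ 2)
  order-two (_ , x²≡e , _) =
    subst (CardI G m x) (sym (triangle-half m)) (card-I-involution x≢e x⁻¹≡x) , regular-involution x≢e x⁻¹≡x
    where
    x⁻¹≡x : x ⁻¹ ≡ x
    x⁻¹≡x = square≡e⇒⁻¹≡ (trans x²≡pow2 x²≡e)

  order-above-two : ∀ k → 2 < k → HasOrder G x k → CardI G m x (m * suc m) × IsRegularI G m x (2 * m ∸ 1)
  order-above-two k 2<k (_ , _ , minimal) =
    subst (CardI G m x) (triangle-double m) (card-I x≢e x²≢e) , regular x≢e x²≢e
    where
    x²≢e : x ∙ x ≢ e
    x²≢e = minimal 2 (s≤s z≤n) 2<k ∘ trans (sym x²≡pow2)
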